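{- (1) Let $\mathcal{I}$ be a $\Delta$-institution. For every signature morphism $\chi:\Sigma\to\Sigma'$, every block $X\in|\Sigma_\Delta|$, and every $\Sigma(X)$-substitution $\theta:\Sigma[X]\to\Sigma$, there is a unique $\Sigma'(\chi_\Delta(X))$-substitution $\theta':\Sigma'[\chi_\Delta(X)]\to\Sigma'$ such that $\theta'\circ\chi[X]=\chi\circ\theta$. (2) Let $M:\mathcal{I}\to\mathcal{I}'$ be a $\Delta$-institution morphism. For every $\Sigma\in|\mathsf{Sig}^{\mathcal{I}}|$, every block $X\in|\mathsf{Sig}^M(\Sigma)_{\Delta'}|$ of $\mathcal{I}'$, and every $\mathsf{Sig}^M(\Sigma)(X)$-substitution $\theta:\mathsf{Sig}^M(\Sigma)[X]\to\mathsf{Sig}^M(\Sigma)$ (in $\mathcal{I}'$), there is a unique $\Sigma(\Sigma_{\Delta^M}(X))$-substitution $\theta':\Sigma[\Sigma_{\Delta^M}(X)]\to\Sigma$ (in $\mathcal{I}$) such that $\mathsf{Sig}^M(\theta')\circ\Sigma^{\Delta^M}[X]=\theta$.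
   Context: A $\Delta$-institution $\mathcal{I}$ consists of a locally small category $\mathsf{Sig}$ of signatures, a functor $\mathsf{Mod}:\mathsf{Sig}^{op}\to\mathbf{CAT}$, a functor $\mathsf{Sen}:\mathsf{Sig}\to\mathbf{Set}$, satisfaction relations $\models_\Sigma\subseteq|\mathsf{Mod}(\Sigma)|\times\mathsf{Sen}(\Sigma)$ with $\mathsf{Mod}(\chi)(\mathfrak{A}')\models\gamma$ iff $\mathfrak{A}'\models\mathsf{Sen}(\chi)(\gamma)$ for all $\chi:\Sigma\to\Sigma'$, $\mathfrak{A}'\in|\mathsf{Mod}(\Sigma')|$, $\gamma\in\mathsf{Sen}(\Sigma)$, together with a variable structure: (i) a functor $(\cdot)_\Delta:\mathsf{Sig}\to\mathbf{Cat}$ (objects of $\Sigma_\Delta$ are called blocks for $\Sigma$; $\chi_\Delta$ denotes its action on $\chi$); (ii) for each $\Sigma$ and $X\in|\Sigma_\Delta|$ a morphism $\Sigma(X):\Sigma\to\Sigma[X]$, and for each $\iota:X\to Y$ in $\Sigma_\Delta$ a morphism $\Sigma[\iota]:\Sigma[X]\to\Sigma[Y]$ with $\Sigma[\iota]\circ\Sigma(X)=\Sigma(Y)$, $\Sigma[\mathrm{id}_X]=\mathrm{id}$, $\Sigma[\iota'\circ\iota]=\Sigma[\iota']\circ\Sigma[\iota]$; (iii) for each $\chi:\Sigma\to\Sigma'$ and $X\in|\Sigma_\Delta|$ a morphism $\chi[X]:\Sigma[X]\to\Sigma'[\chi_\Delta(X)]$ with $\chi[X]\circ\Sigma(X)=\Sigma'(\chi_\Delta(X))\circ\chi$,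 $\chi[Y]\circ\Sigma[\iota]=\Sigma'[\chi_\Delta(\iota)]\circ\chi[X]$, $\mathrm{id}_\Sigma[X]=\mathrm{id}_{\Sigma[X]}$, $(\chi'\circ\chi)[X]=\chi'[\chi_\Delta(X)]\circ\chi[X]$; (iv) (pushout) for all $\chi:\Sigma\to\Sigma'$, $X$, $\tau:\Sigma'\to\Sigma''$, $\sigma:\Sigma[X]\to\Sigma''$ with $\sigma\circ\Sigma(X)=\tau\circ\chi$ there is a unique $u:\Sigma'[\chi_\Delta(X)]\to\Sigma''$ with $u\circ\Sigma'(\chi_\Delta(X))=\tau$ and $u\circ\chi[X]=\sigma$; (v) (expansion) for all $\chi:\Sigma\to\Sigma'$, $\mathfrak{A}'\in|\mathsf{Mod}(\Sigma')|$, $X\in|\Sigma_\Delta|$ and every $\Sigma(X)$-expansion $\hat{\mathfrak{A}}$ of $\mathsf{Mod}(\chi)(\mathfrak{A}')$ (i.e. $\hat{\mathfrak A}\in|\mathsf{Mod}(\Sigma[X])|$ with $\mathsf{Mod}(\Sigma(X))(\hat{\mathfrak A})=\mathsf{Mod}(\chi)(\mathfrak{A}')$) there is a unique $\Sigma'(\chi_\Delta(X))$-expansion $\hat{\mathfrak{A}}'$ of $\mathfrak{A}'$ with $\mathsf{Mod}(\chi[X])(\hat{\mathfrak A}')=\hat{\mathfrak A}$. For a signature morphism $\rho:\Sigma\to\Sigma_1$, a $\rho$-substitution is a morphism $\theta:\Sigma_1\to\Sigma$ with $\theta\circ\rho=\mathrm{id}_\Sigma$. A $\Delta$-institution morphism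 $M:\mathcal{I}\to\mathcal{I}'$ includes (among further components, not involved in this statement) a functor $\mathsf{Sig}^M:\mathsf{Sig}^{\mathcal I}\to\mathsf{Sig}^{\mathcal I'}$ and, for each $\Sigma\in|\mathsf{Sig}^{\mathcal I}|$ and each block $X\in|\mathsf{Sig}^M(\Sigma)_{\Delta'}|$ of $\mathcal I'$, a block $\Sigma_{\Delta^M}(X)\in|\Sigma_\Delta|$ of $\mathcal I$ and a morphism $\Sigma^{\Delta^M}[X]:\mathsf{Sig}^M(\Sigma)[X]\to\mathsf{Sig}^M(\Sigma[\Sigma_{\Delta^M}(X)])$ in $\mathsf{Sig}^{\mathcal I'}$ with $\Sigma^{\Delta^M}[X]\circ\mathsf{Sig}^M(\Sigma)(X)=\mathsf{Sig}^M(\Sigma(\Sigma_{\Delta^M}(X)))$, subject to the universality condition: for every $\rho:\Sigma\to\Sigma''$ in $\mathsf{Sig}^{\mathcal I}$ and every $f:\mathsf{Sig}^M(\Sigma)[X]\to\mathsf{Sig}^M(\Sigma'')$ with $f\circ\mathsf{Sig}^M(\Sigma)(X)=\mathsf{Sig}^M(\rho)$, there is a unique $g:\Sigma[\Sigma_{\Delta^M}(X)]\to\Sigma''$ with $g\circ\Sigma(\Sigma_{\Delta^M}(X))=\rho$ and $\mathsf{Sig}^M(g)\circ\Sigma^{\Delta^M}[X]=f$. -}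

module Defs where

open import Level using (Level; _⊔_; suc)
open import Relation.Binary.PropositionalEquality
  using (_≡_; refl; sym; trans; subst; subst₂; cong)
open import Data.Product using (Σ; _×_; _,_; ∃!; proj₁)
open import Function.Bundles using (_⇔_)

-- Categories with hom-types (locally small: Hom in a type universe),
-- morphism equality is propositional equality.

record Category (o h : Level) : Set (suc (o ⊔ h)) where
  infixr 9 _∘_
  field
    Obj   : Set o
    Hom   : Obj → Obj → Set h
    id    : ∀ {A} → Hom A A
    _∘_   : ∀ {A B C} → Hom B C → Hom A B → Hom A C
    identityˡ : ∀ {A B} (f : Hom A B) → id ∘ f ≡ f
    identityʳ : ∀ {A B} (f : Hom A B) → f ∘ id ≡ f
    assoc : ∀ {A B C D} (f : Hom A B) (g : Hom B C) (h : Hom C D) →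
            (h ∘ g) ∘ f ≡ h ∘ (g ∘ f)

open Category public using (Obj; Hom)

op : ∀ {o h} → Category o h → Category o h
op C = record
  { Obj = Obj C
  ; Hom = λ A B → Hom C B A
  ; id = Category.id C
  ; _∘_ = λ g f → Category._∘_ C f g
  ; identityˡ = Category.identityʳ C
  ; identityʳ = Category.identityˡ C
  ; assoc = λ f g h → sym (Category.assoc C h g f)
  }

record Functor {o h o' h'} (C : Category o h) (D : Category o' h')
       : Set (o ⊔ h ⊔ o' ⊔ h') where
  private
    module C = Category C
    module D = Category D
  field
    F₀ : C.Obj → D.Obj
    F₁ : ∀ {A B} → C.Hom A B → D.Hom (F₀ A) (F₀ B)
    F-id : ∀ {A} → F₁ (C.id {A}) ≡ D.id
    F-∘  : ∀ {A B E} (f : C.Hom A B) (g : C.Hom B E) →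
           F₁ (g C.∘ f) ≡ F₁ g D.∘ F₁ f

open Functor public using (F₀; F₁)

IdF : ∀ {o h} (C : Category o h) → Functor C C
IdF C = record
  { F₀ = λ A → A ; F₁ = λ f → f ; F-id = refl ; F-∘ = λ f g → refl }

_∘F_ : ∀ {o h o' h' o'' h''} {C : Category o h} {D : Category o' h'}
         {E : Category o'' h''} → Functor D E → Functor C D → Functor C E
_∘F_ G F = record
  { F₀ = λ A → F₀ G (F₀ F A)
  ; F₁ = λ f → F₁ G (F₁ F f)
  ; F-id = trans (cong (F₁ G) (Functor.F-id F)) (Functor.F-id G)
  ; F-∘ = λ f g → trans (cong (F₁ G) (Functor.F-∘ F f g))
                        (Functor.F-∘ G (F₁ F f) (F₁ F g))
  }

-- strict (on-the-nose) equality of functors, as equations in CAT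
_≈F_ : ∀ {o h o' h'} {C : Category o h} {D : Category o' h'} →
       Functor C D → Functor C D → Set (o ⊔ h ⊔ o' ⊔ h')
_≈F_ {C = C} {D = D} F G =
  Σ (∀ A → F₀ F A ≡ F₀ G A) λ eq →
    ∀ {A B} (f : Hom C A B) →
      subst₂ (Hom D) (eq A) (eq B) (F₁ F f) ≡ F₁ G f

record FunctorToCat {o h} (C : Category o h) (o' h' : Level)
       : Set (o ⊔ h ⊔ suc (o' ⊔ h')) where
  field
    Ob   : Obj C → Category o' h'
    Ar   : ∀ {A B} → Hom C A B → Functor (Ob A) (Ob B)
    Ar-id : ∀ A → Ar (Category.id C {A}) ≈F IdF (Ob A)
    Ar-∘  : ∀ {A B E} (f : Hom C A B) (g : Hom C B E) →
            Ar (Category._∘_ C g f) ≈F (Ar g ∘F Ar f)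

record FunctorToSet {o h} (C : Category o h) (s : Level)
       : Set (o ⊔ h ⊔ suc s) where
  field
    Ob  : Obj C → Set s
    Ar  : ∀ {A B} → Hom C A B → Ob A → Ob B
    Ar-id : ∀ {A} (x : Ob A) → Ar (Category.id C {A}) x ≡ x
    Ar-∘  : ∀ {A B E} (f : Hom C A B) (g : Hom C B E) (x : Ob A) →
            Ar (Category._∘_ C g f) x ≡ Ar g (Ar f x)

record ΔInstitution (so sh bo bh mo mh s r : Level)
       : Set (suc (so ⊔ sh ⊔ bo ⊔ bh ⊔ mo ⊔ mh ⊔ s ⊔ r)) where
  field
    Sig : Category so sh
  open Category Sig using (id; _∘_)
  field
    Mod : FunctorToCat (op Sig) mo mh
    Sen : FunctorToSet Sig s
    Sat : ∀ Σ₀ → Obj (FunctorToCat.Ob Mod Σ₀) → FunctorToSet.Ob Sen Σ₀ → Set r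
  ModR : ∀ {Σ₀ Σ₁} → Hom Sig Σ₀ Σ₁ →
         Obj (FunctorToCat.Ob Mod Σ₁) → Obj (FunctorToCat.Ob Mod Σ₀)
  ModR χ = F₀ (FunctorToCat.Ar Mod χ)
  SenT : ∀ {Σ₀ Σ₁} → Hom Sig Σ₀ Σ₁ →
         FunctorToSet.Ob Sen Σ₀ → FunctorToSet.Ob Sen Σ₁
  SenT = FunctorToSet.Ar Sen
  field
    satisfaction : ∀ {Σ₀ Σ₁} (χ : Hom Sig Σ₀ Σ₁)
      (A' : Obj (FunctorToCat.Ob Mod Σ₁)) (γ : FunctorToSet.Ob Sen Σ₀) →
      Sat Σ₀ (ModR χ A') γ ⇔ Sat Σ₁ A' (SenT χ γ)
    Δ : FunctorToCat Sig bo bh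
  -- Σ_Δ, blocks, and χ_Δ
  Blk : Obj Sig → Category bo bh
  Blk = FunctorToCat.Ob Δ
  _Δ₀_ : ∀ {Σ₀ Σ₁} → Hom Sig Σ₀ Σ₁ → Obj (Blk Σ₀) → Obj (Blk Σ₁)
  χ Δ₀ X = F₀ (FunctorToCat.Ar Δ χ) X
  _Δ₁_ : ∀ {Σ₀ Σ₁} (χ : Hom Sig Σ₀ Σ₁) {X Y} → Hom (Blk Σ₀) X Y →
         Hom (Blk Σ₁) (χ Δ₀ X) (χ Δ₀ Y)
  χ Δ₁ ι = F₁ (FunctorToCat.Ar Δ χ) ι
  field
    _[_] : ∀ Σ₀ → Obj (Blk Σ₀) → Obj Sig
    _⟨_⟩ : ∀ Σ₀ (X : Obj (Blk Σ₀)) → Hom Sig Σ₀ (Σ₀ [ X ])   -- Σ(X)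
    _[_]ᵐ : ∀ Σ₀ {X Y} → Hom (Blk Σ₀) X Y → Hom Sig (Σ₀ [ X ]) (Σ₀ [ Y ])
    ext-inj : ∀ Σ₀ {X Y} (ι : Hom (Blk Σ₀) X Y) →
              (Σ₀ [ ι ]ᵐ) ∘ (Σ₀ ⟨ X ⟩) ≡ Σ₀ ⟨ Y ⟩
    ext-id : ∀ Σ₀ {X} → Σ₀ [ Category.id (Blk Σ₀) {X} ]ᵐ ≡ id
    ext-∘ : ∀ Σ₀ {X Y Z} (ι : Hom (Blk Σ₀) X Y) (ι' : Hom (Blk Σ₀) Y Z) →
            Σ₀ [ Category._∘_ (Blk Σ₀) ι' ι ]ᵐ ≡ (Σ₀ [ ι' ]ᵐ) ∘ (Σ₀ [ ι ]ᵐ)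
    -- (iii)  χ[X]
    _⟦_⟧ : ∀ {Σ₀ Σ₁} (χ : Hom Sig Σ₀ Σ₁) (X : Obj (Blk Σ₀)) →
           Hom Sig (Σ₀ [ X ]) (Σ₁ [ χ Δ₀ X ])
    tr-inj : ∀ {Σ₀ Σ₁} (χ : Hom Sig Σ₀ Σ₁) (X : Obj (Blk Σ₀)) →
             (χ ⟦ X ⟧) ∘ (Σ₀ ⟨ X ⟩) ≡ (Σ₁ ⟨ χ Δ₀ X ⟩) ∘ χ
    tr-nat : ∀ {Σ₀ Σ₁} (χ : Hom Sig Σ₀ Σ₁) {X Y} (ι : Hom (Blk Σ₀) X Y) →
             (χ ⟦ Y ⟧) ∘ (Σ₀ [ ι ]ᵐ) ≡ (Σ₁ [ χ Δ₁ ι ]ᵐ) ∘ (χ ⟦ X ⟧)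
    tr-id : ∀ Σ₀ (X : Obj (Blk Σ₀)) →
            subst (λ Z → Hom Sig (Σ₀ [ X ]) (Σ₀ [ Z ]))
                  (proj₁ (FunctorToCat.Ar-id Δ Σ₀) X) (id ⟦ X ⟧) ≡ id
    tr-∘ : ∀ {Σ₀ Σ₁ Σ₂} (χ : Hom Sig Σ₀ Σ₁) (χ' : Hom Sig Σ₁ Σ₂) (X : Obj (Blk Σ₀)) →
           subst (λ Z → Hom Sig (Σ₀ [ X ]) (Σ₂ [ Z ]))
                 (proj₁ (FunctorToCat.Ar-∘ Δ χ χ') X) ((χ' ∘ χ) ⟦ X ⟧)
             ≡ (χ' ⟦ χ Δ₀ X ⟧) ∘ (χ ⟦ X ⟧)
    pushout : ∀ {Σ₀ Σ₁ Σ₂} (χ : Hom Sig Σ₀ Σ₁) (X : Obj (Blk Σ₀))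
      (τ : Hom Sig Σ₁ Σ₂) (σ : Hom Sig (Σ₀ [ X ]) Σ₂) →
      σ ∘ (Σ₀ ⟨ X ⟩) ≡ τ ∘ χ →
      ∃! _≡_ λ (u : Hom Sig (Σ₁ [ χ Δ₀ X ]) Σ₂) →
        (u ∘ (Σ₁ ⟨ χ Δ₀ X ⟩) ≡ τ) × (u ∘ (χ ⟦ X ⟧) ≡ σ)
    expansion : ∀ {Σ₀ Σ₁} (χ : Hom Sig Σ₀ Σ₁)
      (A' : Obj (FunctorToCat.Ob Mod Σ₁)) (X : Obj (Blk Σ₀))
      (Â : Obj (FunctorToCat.Ob Mod (Σ₀ [ X ]))) →
      ModR (Σ₀ ⟨ X ⟩) Â ≡ ModR χ A' →
      ∃! _≡_ λ (Â' : Obj (FunctorToCat.Ob Mod (Σ₁ [ χ Δ₀ X ]))) →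
        (ModR (Σ₁ ⟨ χ Δ₀ X ⟩) Â' ≡ A') × (ModR (χ ⟦ X ⟧) Â' ≡ Â)

IsSubstitution : ∀ {o h} (C : Category o h) {A B : Obj C} →
                 Hom C A B → Hom C B A → Set h
IsSubstitution C ρ θ = Category._∘_ C θ ρ ≡ Category.id C

-- Δ-institution morphisms (only the components given in the paper's
-- context; the further components are not involved in the statement)

record ΔInstitutionMorphism
  {so sh bo bh mo mh s r so' sh' bo' bh' mo' mh' s' r' : Level}
  (I  : ΔInstitution so sh bo bh mo mh s r)
  (I' : ΔInstitution so' sh' bo' bh' mo' mh' s' r')
  : Set (so ⊔ sh ⊔ bo ⊔ bh ⊔ so' ⊔ sh' ⊔ bo' ⊔ bh') where
  private
    module I  = ΔInstitution I
    module I' = ΔInstitution I'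
    _∘_  = Category._∘_ I.Sig
    _∘'_ = Category._∘_ I'.Sig
  field
    SigM : Functor I.Sig I'.Sig
    -- Σ_{Δ^M}(X)
    BlkM : ∀ Σ₀ → Obj (I'.Blk (F₀ SigM Σ₀)) → Obj (I.Blk Σ₀)
    -- Σ^{Δ^M}[X]
    ExtM : ∀ Σ₀ (X : Obj (I'.Blk (F₀ SigM Σ₀))) →
           Hom I'.Sig ((F₀ SigM Σ₀) I'.[ X ]) (F₀ SigM (Σ₀ I.[ BlkM Σ₀ X ]))
    ExtM-inj : ∀ Σ₀ (X : Obj (I'.Blk (F₀ SigM Σ₀))) →
           ExtM Σ₀ X ∘' ((F₀ SigM Σ₀) I'.⟨ X ⟩) ≡ F₁ SigM (Σ₀ I.⟨ BlkM Σ₀ X ⟩)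
    universality : ∀ Σ₀ (X : Obj (I'.Blk (F₀ SigM Σ₀))) {Σ₂}
      (ρ : Hom I.Sig Σ₀ Σ₂)
      (f : Hom I'.Sig ((F₀ SigM Σ₀) I'.[ X ]) (F₀ SigM Σ₂)) →
      f ∘' ((F₀ SigM Σ₀) I'.⟨ X ⟩) ≡ F₁ SigM ρ →
      ∃! _≡_ λ (g : Hom I.Sig (Σ₀ I.[ BlkM Σ₀ X ]) Σ₂) →
        (g ∘ (Σ₀ I.⟨ BlkM Σ₀ X ⟩) ≡ ρ) × (F₁ SigM g ∘' ExtM Σ₀ X ≡ f)

{-# OPTIONS --safe #-}
module Submission where

-- Both parts are universal properties instantiated with an identity leg.
-- (1) Since θ restricts to the identity on Σ, the cocone (id_Σ', χ ∘ θ) commutes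
-- over Σ; its unique mediator out of the pushout Σ'[χ_Δ(X)] is θ', the two
-- mediating equations being exactly "θ' is a substitution" and θ' ∘ χ[X] = χ ∘ θ.
-- (2) θ agrees with Sig^M(id_Σ) on Sig^M(Σ), so universality of Σ^{Δ^M}[X] with
-- ρ = id_Σ gives θ'.

open import Defs
open import Level using (Level)
open import Relation.Binary.PropositionalEquality using (_≡_; sym; trans; cong; module ≡-Reasoning)
open import Data.Product using (_×_; ∃!; _,_)

module _ {o h : Level} (C : Category o h) where
  open Category C using (id; _∘_; assoc; identityˡ; identityʳ)

  substitution-square : ∀ {A B D} {ρ : Hom C A B} {θ : Hom C B A} (χ : Hom C A D) →
                        IsSubstitution C ρ θ → (χ ∘ θ) ∘ ρ ≡ id ∘ χ
  substitution-square {ρ = ρ} {θ} χ θ∘ρ≡id = begin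
    (χ ∘ θ) ∘ ρ  ≡⟨ assoc ρ θ χ ⟩
    χ ∘ (θ ∘ ρ)  ≡⟨ cong (χ ∘_) θ∘ρ≡id ⟩
    χ ∘ id       ≡⟨ identityʳ χ ⟩
    χ            ≡⟨ identityˡ χ ⟨
    id ∘ χ       ∎
    where open ≡-Reasoning

module _ {so sh bo bh mo mh s r : Level} (I : ΔInstitution so sh bo bh mo mh s r) where
  open ΔInstitution I
  open Category Sig using (id; _∘_)

  substitution-translation :
    ∀ {Σ₀ Σ₁} (χ : Hom Sig Σ₀ Σ₁) (X : Obj (Blk Σ₀)) (θ : Hom Sig (Σ₀ [ X ]) Σ₀) →
    IsSubstitution Sig (Σ₀ ⟨ X ⟩) θ →
    ∃! _≡_ λ (θ' : Hom Sig (Σ₁ [ χ Δ₀ X ]) Σ₁) →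
      IsSubstitution Sig (Σ₁ ⟨ χ Δ₀ X ⟩) θ' × (θ' ∘ (χ ⟦ X ⟧) ≡ χ ∘ θ)
  substitution-translation χ X θ θ-subst =
    pushout χ X id (χ ∘ θ) (substitution-square Sig χ θ-subst)

module _ {so sh bo bh mo mh s r so' sh' bo' bh' mo' mh' s' r' : Level}
         {I : ΔInstitution so sh bo bh mo mh s r}
         {I' : ΔInstitution so' sh' bo' bh' mo' mh' s' r'}
         (M : ΔInstitutionMorphism I I') where
  private
    module I = ΔInstitution I
    module I' = ΔInstitution I'
  open ΔInstitutionMorphism M
  open Category I'.Sig using () renaming (_∘_ to _∘'_)

  substitution-reflection :
    ∀ (Σ₀ : Obj I.Sig) (X : Obj (I'.Blk (F₀ SigM Σ₀)))
      (θ : Hom I'.Sig ((F₀ SigM Σ₀) I'.[ X ]) (F₀ SigM Σ₀)) →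
    IsSubstitution I'.Sig ((F₀ SigM Σ₀) I'.⟨ X ⟩) θ →
    ∃! _≡_ λ (θ' : Hom I.Sig (Σ₀ I.[ BlkM Σ₀ X ]) Σ₀) →
      IsSubstitution I.Sig (Σ₀ I.⟨ BlkM Σ₀ X ⟩) θ' × (F₁ SigM θ' ∘' ExtM Σ₀ X ≡ θ)
  substitution-reflection Σ₀ X θ θ-subst =
    universality Σ₀ X (Category.id I.Sig) θ (trans θ-subst (sym (Functor.F-id SigM)))

lemma3p10 : ∀ {so sh bo bh mo mh s r so' sh' bo' bh' mo' mh' s' r' : Level} →
  -- (1)
  ((I : ΔInstitution so sh bo bh mo mh s r) →
    let open ΔInstitution I
        open Category Sig using (_∘_)
    in ∀ {Σ₀ Σ₁} (χ : Hom Sig Σ₀ Σ₁) (X : Obj (Blk Σ₀))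
         (θ : Hom Sig (Σ₀ [ X ]) Σ₀) →
       IsSubstitution Sig (Σ₀ ⟨ X ⟩) θ →
       ∃! _≡_ λ (θ' : Hom Sig (Σ₁ [ χ Δ₀ X ]) Σ₁) →
         IsSubstitution Sig (Σ₁ ⟨ χ Δ₀ X ⟩) θ' ×
         (θ' ∘ (χ ⟦ X ⟧) ≡ χ ∘ θ))
  ×
  -- (2)
  ((I : ΔInstitution so sh bo bh mo mh s r)
   (I' : ΔInstitution so' sh' bo' bh' mo' mh' s' r')
   (M : ΔInstitutionMorphism I I') →
    let module I = ΔInstitution I
        module I' = ΔInstitution I'
        open ΔInstitutionMorphism M
        open Category I'.Sig using () renaming (_∘_ to _∘'_)
    in ∀ (Σ₀ : Obj I.Sig) (X : Obj (I'.Blk (F₀ SigM Σ₀)))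
         (θ : Hom I'.Sig ((F₀ SigM Σ₀) I'.[ X ]) (F₀ SigM Σ₀)) →
       IsSubstitution I'.Sig ((F₀ SigM Σ₀) I'.⟨ X ⟩) θ →
       ∃! _≡_ λ (θ' : Hom I.Sig (Σ₀ I.[ BlkM Σ₀ X ]) Σ₀) →
         IsSubstitution I.Sig (Σ₀ I.⟨ BlkM Σ₀ X ⟩) θ' ×
         (F₁ SigM θ' ∘' ExtM Σ₀ X ≡ θ))
lemma3p10 = (λ I → substitution-translation I) , (λ I I' M → substitution-reflection M)
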